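{- Let $\Phi$ be a 3-CNF formula with $n$ variables and $m$ clauses and let $\pi$ be the permutation constructed from $\Phi$ as described in the context. Then there exists a block sorting schedule for $\pi$ of length $7m+2n-1$.
   Context: Block sorting: for a permutation of a totally ordered finite set, a block is a maximal substring that is also a substring of the sorted sequence; a block move removes a block and reinserts it elsewhere; a block sorting schedule is a sequence of block moves that sorts the permutation. Construction: $\Phi$ has variables $x_1,\dots,x_n$ and clauses $\mathcal{C}^1,\dots,\mathcal{C}^m$, each of the form $(z_a\vee z_b\vee z_c)$ with $a>b>c$, $z_i\in\{x_i,\bar x_i\}$. Symbols: $p_i^j,\bar p_i^j,q_i^j,\bar q_i^j$ ($1\le i\le n$, $1\le j\le m$); $\ell^j,r^j$ ($1\le j\le m+n$); $u_i,\upsilon_i$ ($1\le i\le n$); $s$. Order: $u_i<p_i^k<p_i^j<\bar p_i^k<\bar p_i^j<q_i^j<q_i^k<\bar q_i^j<\bar q_i^k<\upsilon_i<s$ for $1\le i\le n$, $1\le j<k\le m$; $\upsilon_{i-1}<u_i$; $s<\ell^k<r^k<\ell^j<r^j$ for $1\le j<k\le m+n$. Literal $x_i$ in clause $j$ has left symbol $p_i^j$ and right symbol $q_i^j$; $\bar x_i$ has $\bar p_i^j,\bar q_i^j$. Clause $\mathcal{C}^j=(z_a\vee z_b\vee z_c)$ is encoded as $\ell^j$, the left symbols of $z_a,z_b,z_c$, the right symbols of $z_a,z_b,z_c$, then $r^j$. $\pi$ is: $s$, then the encodings of $\mathcal{C}^1,\dots,\mathcal{C}^m$ in order, then $\ell^{m+i}u_i\upsilon_ir^{m+i}$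 for $i=1,\dots,n$; it has $8m+4n+1$ elements. -}

module Defs where

open import Data.Nat using (ℕ; zero; suc; _+_; _*_; _∸_; _≤_; _<_; _>_)
open import Data.Nat.Properties using (≤-decTotalOrder)
open import Data.Fin using (Fin; toℕ)
open import Data.Bool using (Bool; true; false)
open import Data.List using (List; []; _∷_; _++_; take; drop; length; map; concat)
open import Data.Vec using (Vec; toList)
open import Data.Product using (Σ; ∃; ∃-syntax; _×_; _,_)
open import Relation.Binary.PropositionalEquality using (_≡_; _≢_)
open import Data.List.Sort.InsertionSort ≤-decTotalOrder using (sort)

sorted : List ℕ → List ℕ
sorted = sort

Substring : List ℕ → List ℕ → Set
Substring b ys = ∃[ a ] ∃[ c ] (ys ≡ a ++ b ++ c)

IsBlockAt : List ℕ → List ℕ → List ℕ → List ℕ → Set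
IsBlockAt xs l b r =
  (xs ≡ l ++ b ++ r)
  × (b ≢ [])
  × Substring b (sorted xs)
  × (∀ l₁ l₂ r₁ r₂ → l ≡ l₁ ++ l₂ → r ≡ r₁ ++ r₂ →
       Substring (l₂ ++ b ++ r₁) (sorted xs) → (l₂ ≡ []) × (r₁ ≡ []))

BlockMove : List ℕ → List ℕ → Set
BlockMove xs ys =
  ∃[ l ] ∃[ b ] ∃[ r ] ∃[ k ]
    IsBlockAt xs l b r
    × (k ≤ length (l ++ r))
    × (k ≢ length l)
    × (ys ≡ take k (l ++ r) ++ b ++ drop k (l ++ r))

data Moves : ℕ → List ℕ → List ℕ → Set where
  done : ∀ {xs} → Moves zero xs xs
  step : ∀ {t xs ys zs} → BlockMove xs ys → Moves t ys zs → Moves (suc t) xs zs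

BlockSortingSchedule : List ℕ → ℕ → Set
BlockSortingSchedule xs t = Moves t xs (sorted xs)

record Literal (n : ℕ) : Set where
  constructor lit
  field
    var : Fin n
    positive : Bool

record Clause (n : ℕ) : Set where
  constructor clause
  field
    za zb zc : Literal n
    a>b : toℕ (Literal.var za) > toℕ (Literal.var zb)
    b>c : toℕ (Literal.var zb) > toℕ (Literal.var zc)

CNF3 : ℕ → ℕ → Set
CNF3 n m = Vec (Clause n) m

-- The symbols and their total order, realised by an order embedding
-- (rank) into ℕ.  Indices are 0-based: variable i : Fin n is x_{i+1},
-- clause j : Fin m is C^{j+1}, k : Fin (m + n) is index k+1 of ℓ/r.

data Sym (n m : ℕ) : Set where
  p  : Fin n → Fin m → Bool → Sym n m   -- p i j true = p_i^j, p i j false = p̄_i^j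
  q  : Fin n → Fin m → Bool → Sym n m   -- likewise q_i^j, q̄_i^j
  ℓ  : Fin (m + n) → Sym n m
  r  : Fin (m + n) → Sym n m
  u  : Fin n → Sym n m
  υ  : Fin n → Sym n m
  s  : Sym n m

-- Order: u_i < p_i^m < … < p_i^1 < p̄_i^m < … < p̄_i^1 < q_i^1 < … < q_i^m
--        < q̄_i^1 < … < q̄_i^m < υ_i < u_{i+1} < … < υ_n < s
--        < ℓ^{m+n} < r^{m+n} < … < ℓ^1 < r^1
rank : ∀ {n m} → Sym n m → ℕ
rank {n} {m} (p i j true)  = toℕ i * (4 * m + 2) + 1 + (m ∸ suc (toℕ j))
rank {n} {m} (p i j false) = toℕ i * (4 * m + 2) + 1 + m + (m ∸ suc (toℕ j))
rank {n} {m} (q i j true)  = toℕ i * (4 * m + 2) + 1 + 2 * m + toℕ j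
rank {n} {m} (q i j false) = toℕ i * (4 * m + 2) + 1 + 3 * m + toℕ j
rank {n} {m} (ℓ k) = n * (4 * m + 2) + 1 + 2 * (m + n ∸ suc (toℕ k))
rank {n} {m} (r k) = n * (4 * m + 2) + 2 + 2 * (m + n ∸ suc (toℕ k))
rank {n} {m} (u i) = toℕ i * (4 * m + 2)
rank {n} {m} (υ i) = toℕ i * (4 * m + 2) + 4 * m + 1
rank {n} {m} s = n * (4 * m + 2)

leftSym : ∀ {n m} → Fin m → Literal n → Sym n m
leftSym j (lit i b) = p i j b

rightSym : ∀ {n m} → Fin m → Literal n → Sym n m
rightSym j (lit i b) = q i j b

encodeClause : ∀ {n m} → Fin m → Clause n → List (Sym n m)
encodeClause {n} {m} j (clause za zb zc _ _) =
  ℓ (j Data.Fin.↑ˡ n)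
  ∷ leftSym j za ∷ leftSym j zb ∷ leftSym j zc
  ∷ rightSym j za ∷ rightSym j zb ∷ rightSym j zc
  ∷ r (j Data.Fin.↑ˡ n) ∷ []

encodeClauses : ∀ {n m} → CNF3 n m → List (Sym n m)
encodeClauses {n} {m} Φ =
  concat (toList (Data.Vec.zipWith encodeClause (Data.Vec.allFin m) Φ))

encodeVars : ∀ {n m} → List (Sym n m)
encodeVars {n} {m} =
  concat (map (λ i → ℓ (m Data.Fin.↑ʳ i) ∷ u i ∷ υ i ∷ r (m Data.Fin.↑ʳ i) ∷ [])
              (Data.List.allFin n))

πSyms : ∀ {n m} → CNF3 n m → List (Sym n m)
πSyms Φ = s ∷ encodeClauses Φ ++ encodeVars

π : ∀ {n m} → CNF3 n m → List ℕ
π Φ = map rank (πSyms Φ)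

-- The schedule works in three phases.  First, for each clause in turn, its six literal
-- symbols are moved one at a time into the stretch u_i … υ_i of their variable, at their
-- sorted place (6m moves); this leaves ℓ^j r^j in place of the clause.  Then each stretch
-- u_i … υ_i, now sorted, is moved in front of s (n moves).  Finally the m + n pairs ℓ^k r^k
-- stand behind s in reverse order and m + n − 1 moves sort them.  Every piece moved is a
-- block because its outer neighbours are not adjacent to its ends in the sorted sequence:
-- they are descending, or some other symbol (such as υ_i or s) lies strictly between them.
-- Block moves preserve the multiset, so the sorted sequence is the same explicit list F
-- all along.

module Submission where

open import Defs
open import Data.Bool using (true; false)
open import Data.Empty using (⊥-elim)
open import Data.Nat using (ℕ; zero; suc; _+_; _*_; _∸_; _≤_; _<_; z≤n; s≤s)
import Data.Nat.Properties as ℕP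
open import Data.Fin as Fin using (Fin; toℕ; _↑ˡ_; _↑ʳ_)
import Data.Fin.Properties as FinP
open import Data.List
  using (List; []; _∷_; _++_; _∷ʳ_; _ʳ++_; length; take; drop; reverse; concat; map; tabulate; applyUpTo)
import Data.List.Properties as ListP
open import Data.List.Membership.Propositional using (_∈_)
import Data.List.Membership.Propositional.Properties as ∈P
open import Data.List.Relation.Binary.Permutation.Propositional
  using (_↭_; ↭-refl; ↭-trans; ↭-sym; ↭-reflexive; ↭⇒↭ₛ′)
import Data.List.Relation.Binary.Permutation.Propositional.Properties as ↭P
import Data.List.Relation.Binary.Pointwise as Pointwise
open import Data.List.Relation.Unary.All as All using (All; []; _∷_)
import Data.List.Relation.Unary.All.Properties as AllP
open import Data.List.Relation.Unary.AllPairs using (AllPairs; []; _∷_)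
import Data.List.Relation.Unary.AllPairs.Properties as AllPairsP
open import Data.List.Relation.Unary.Any using (here; there)
open import Data.List.Relation.Unary.Linked as Linked using (Linked; []; [-]; _∷_)
import Data.List.Relation.Unary.Linked.Properties as LinkedP
import Data.List.Relation.Unary.Sorted.TotalOrder.Properties as SortedP
open import Data.List.Sort.InsertionSort.Base ℕP.≤-decTotalOrder using (insert)
import Data.List.Sort.InsertionSort.Properties ℕP.≤-decTotalOrder as InsertionSortP
open import Data.Nat.Tactic.RingSolver using (solve-∀)
open import Data.Product using (∃-syntax; _×_; _,_; proj₁; proj₂)
open import Data.Sum using (_⊎_; inj₁; inj₂)
open import Data.Vec as V using (Vec; toList)
open import Data.Vec.Functional using (Vector; updateAt)
import Data.Vec.Functional.Properties as VecFP
open import Function using (_∘_; flip; id)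
open import Relation.Binary.PropositionalEquality
open import Relation.Nullary using (¬_; yes; no; does)
open import Tactic.MonoidSolver using (solve)

open ≡-Reasoning

Ascending : List ℕ → Set
Ascending = AllPairs _≤_

Adjacent : List ℕ → ℕ → ℕ → Set
Adjacent F x y = Substring (x ∷ y ∷ []) F

substring-middle : ∀ {F} a b c → Substring (a ++ b ++ c) F → Substring b F
substring-middle {F} a b c (a′ , c′ , F≡) = a′ ++ a , c ++ c′ , (begin
  F                            ≡⟨ F≡ ⟩
  a′ ++ (a ++ b ++ c) ++ c′    ≡⟨ cong (a′ ++_) (ListP.++-assoc a (b ++ c) c′) ⟩
  a′ ++ a ++ (b ++ c) ++ c′    ≡⟨ cong (λ t → a′ ++ a ++ t) (ListP.++-assoc b c c′) ⟩
  a′ ++ a ++ b ++ c ++ c′      ≡⟨ ListP.++-assoc a′ a _ ⟨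
  (a′ ++ a) ++ b ++ c ++ c′    ∎)

substring⇒∈ : ∀ {F x xs} → Substring (x ∷ xs) F → x ∈ F
substring⇒∈ (a , _ , refl) = ∈P.∈-++⁺ʳ a (here refl)

∈⇒substring : ∀ {F x} → x ∈ F → Substring (x ∷ []) F
∈⇒substring x∈F = let a , c , eq = ∈P.∈-∃++ x∈F in a , c , eq

ascending-++⁻ : ∀ a {b} → Ascending (a ++ b) → All (λ x → All (x ≤_) b) a × Ascending b
ascending-++⁻ []      asc       = [] , asc
ascending-++⁻ (x ∷ a) (x≤ ∷ asc) =
  let a≤b , b↑ = ascending-++⁻ a asc in AllP.++⁻ʳ a x≤ ∷ a≤b , b↑

adjacent-ascending : ∀ {F y x} → Ascending F → Adjacent F y x →
                     y ≤ x × (∀ {z} → z ∈ F → z ≤ y ⊎ x ≤ z)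
adjacent-ascending {y = y} {x} asc (a , c , refl) with ascending-++⁻ a asc
... | a≤ , ((y≤x ∷ _) ∷ x≤c ∷ _) = y≤x , between
  where
  between : ∀ {z} → z ∈ a ++ y ∷ x ∷ c → z ≤ y ⊎ x ≤ z
  between z∈ with ∈P.∈-++⁻ a z∈
  ... | inj₁ z∈a                  = inj₁ (All.head (All.lookup a≤ z∈a))
  ... | inj₂ (here refl)          = inj₁ ℕP.≤-refl
  ... | inj₂ (there (here refl))  = inj₂ ℕP.≤-refl
  ... | inj₂ (there (there z∈c))  = inj₂ (All.lookup x≤c z∈c)

¬adjacent-descending : ∀ {F y x} → Ascending F → x < y → ¬ Adjacent F y x
¬adjacent-descending asc x<y adj = ℕP.<⇒≱ x<y (proj₁ (adjacent-ascending asc adj))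

¬adjacent-gap : ∀ {F y x z} → Ascending F → z ∈ F → y < z → z < x → ¬ Adjacent F y x
¬adjacent-gap asc z∈F y<z z<x adj with proj₂ (adjacent-ascending asc adj) z∈F
... | inj₁ z≤y = ℕP.<⇒≱ y<z z≤y
... | inj₂ x≤z = ℕP.<⇒≱ z<x x≤z

-- Blocks and block moves relative to a fixed sorted sequence

Maximal : List ℕ → List ℕ → List ℕ → List ℕ → Set
Maximal F l b rt = ∀ l₁ l₂ r₁ r₂ → l ≡ l₁ ++ l₂ → rt ≡ r₁ ++ r₂ →
  Substring (l₂ ++ b ++ r₁) F → (l₂ ≡ []) × (r₁ ≡ [])

-- IsBlockAt xs l b rt is definitionally (xs ≡ l ++ b ++ rt) × BlockIn (sorted xs) l b rt.
BlockIn : List ℕ → List ℕ → List ℕ → List ℕ → Set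
BlockIn F l b rt = (b ≢ []) × Substring b F × Maximal F l b rt

suffix-of-∷ʳ : ∀ (l₁ l₂ l : List ℕ) y → l₁ ++ l₂ ≡ l ∷ʳ y → l₂ ≡ [] ⊎ ∃[ z ] l₂ ≡ z ∷ʳ y
suffix-of-∷ʳ []       l₂ l       y eq = inj₂ (l , eq)
suffix-of-∷ʳ (_ ∷ l₁) l₂ []      y eq = inj₁ (ListP.++-conicalʳ l₁ l₂ (ListP.∷-injectiveʳ eq))
suffix-of-∷ʳ (_ ∷ l₁) l₂ (_ ∷ l) y eq = suffix-of-∷ʳ l₁ l₂ l y (ListP.∷-injectiveʳ eq)

record Detachable (F : List ℕ) (y : ℕ) (b : List ℕ) (w : ℕ) : Set where
  field
    first last  : ℕ
    rest init   : List ℕ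
    starts      : b ≡ first ∷ rest
    ends        : b ≡ init ∷ʳ last
    substring   : Substring b F
    apart-left  : ¬ Adjacent F y first
    apart-right : ¬ Adjacent F last w

detachable⇒block : ∀ {F y b w} P R → Detachable F y b w → BlockIn F (P ∷ʳ y) b (w ∷ R)
detachable⇒block {F} {y} {b} {w} P R d = nonempty , substring , maximal
  where
  open Detachable d
  nonempty : b ≢ []
  nonempty b≡[] with trans (sym starts) b≡[]
  ... | ()
  maximal : Maximal F (P ∷ʳ y) b (w ∷ R)
  maximal l₁ l₂ r₁ r₂ P∷ʳy≡ w∷R≡ sub =
    nothing-left l₂ (suffix-of-∷ʳ l₁ l₂ P y (sym P∷ʳy≡)) sub , nothing-right r₁ w∷R≡ sub
    where
    nothing-left : ∀ l₂ → l₂ ≡ [] ⊎ ∃[ z ] l₂ ≡ z ∷ʳ y → Substring (l₂ ++ b ++ r₁) F → l₂ ≡ []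
    nothing-left _ (inj₁ l₂≡[])      _    = l₂≡[]
    nothing-left _ (inj₂ (z , refl)) sub′ = ⊥-elim (apart-left (substring-middle z (y ∷ first ∷ []) _
      (subst (λ t → Substring t F)
             (trans (cong (λ t → (z ∷ʳ y) ++ t ++ r₁) starts) (ListP.++-assoc z _ _)) sub′)))
    nothing-right : ∀ r₁ → w ∷ R ≡ r₁ ++ r₂ → Substring (l₂ ++ b ++ r₁) F → r₁ ≡ []
    nothing-right []        _  _   = refl
    nothing-right (_ ∷ r₁′) eq sub′ with ListP.∷-injectiveˡ eq
    ... | refl = ⊥-elim (apart-right (substring-middle (l₂ ++ init) (last ∷ w ∷ []) r₁′
                   (subst (λ t → Substring t F) regroup sub′)))
      where
      regroup : l₂ ++ b ++ w ∷ r₁′ ≡ (l₂ ++ init) ++ last ∷ w ∷ r₁′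
      regroup = begin
        l₂ ++ b ++ w ∷ r₁′                ≡⟨ cong (λ t → l₂ ++ t ++ w ∷ r₁′) ends ⟩
        l₂ ++ (init ∷ʳ last) ++ w ∷ r₁′   ≡⟨ cong (l₂ ++_) (ListP.++-assoc init _ _) ⟩
        l₂ ++ init ++ last ∷ w ∷ r₁′      ≡⟨ ListP.++-assoc l₂ init _ ⟨
        (l₂ ++ init) ++ last ∷ w ∷ r₁′    ∎

singleton-detachable : ∀ {F y x w} → x ∈ F → ¬ Adjacent F y x → ¬ Adjacent F x w → Detachable F y (x ∷ []) w
singleton-detachable {x = x} x∈F y≁x x≁w = record
  { first = x ; last = x ; rest = [] ; init = [] ; starts = refl ; ends = refl
  ; substring = ∈⇒substring x∈F ; apart-left = y≁x ; apart-right = x≁w }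

record MoveIn (F xs ys : List ℕ) : Set where
  field
    left block right before after : List ℕ
    source    : xs ≡ left ++ block ++ right
    target    : ys ≡ before ++ block ++ after
    remainder : left ++ right ≡ before ++ after
    displaced : length before ≢ length left
    isBlock   : BlockIn F left block right

length-++-≢ : ∀ (P : List ℕ) {Q} → Q ≢ [] → length P ≢ length (P ++ Q)
length-++-≢ []      {[]}    Q≢[] _  = Q≢[] refl
length-++-≢ []      {_ ∷ _} _    ()
length-++-≢ (_ ∷ P)         Q≢[] eq = length-++-≢ P Q≢[] (ℕP.suc-injective eq)

forward-move : ∀ {F y b w} P Q S → Detachable F y b w →
               MoveIn F (P ++ y ∷ b ++ w ∷ Q ++ S) (P ++ y ∷ w ∷ Q ++ b ++ S)
forward-move {y = y} {b} {w} P Q S d = record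
  { left = P ∷ʳ y ; block = b ; right = w ∷ Q ++ S ; before = P ++ y ∷ w ∷ Q ; after = S
  ; source    = sym (ListP.++-assoc P _ _)
  ; target    = sym (ListP.++-assoc P _ _)
  ; remainder = trans (ListP.++-assoc P _ _) (sym (ListP.++-assoc P _ _))
  ; displaced = λ eq → length-++-≢ (P ∷ʳ y) {w ∷ Q} (λ ())
                  (trans (sym eq) (cong length (sym (ListP.++-assoc P (y ∷ []) (w ∷ Q)))))
  ; isBlock   = detachable⇒block P (Q ++ S) d
  }

backward-move : ∀ {F y b w} P Q S → Detachable F y b w →
                MoveIn F (P ++ Q ++ y ∷ b ++ w ∷ S) (P ++ b ++ Q ++ y ∷ w ∷ S)
backward-move {y = y} {b} {w} P Q S d = record
  { left = (P ++ Q) ∷ʳ y ; block = b ; right = w ∷ S ; before = P ; after = Q ++ y ∷ w ∷ S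
  ; source    = sym (regroup (b ++ w ∷ S))
  ; target    = refl
  ; remainder = regroup (w ∷ S)
  ; displaced = λ eq → length-++-≢ P {Q ∷ʳ y} (λ e → case-[] (ListP.++-conicalʳ Q _ e))
                  (trans eq (cong length (ListP.++-assoc P Q (y ∷ []))))
  ; isBlock   = detachable⇒block (P ++ Q) S d
  }
  where
  regroup : ∀ X → ((P ++ Q) ∷ʳ y) ++ X ≡ P ++ Q ++ y ∷ X
  regroup X = trans (ListP.++-assoc (P ++ Q) _ X) (ListP.++-assoc P Q _)
  case-[] : y ∷ [] ≢ []
  case-[] ()

data MovesIn (F : List ℕ) : ℕ → List ℕ → List ℕ → Set where
  []  : ∀ {xs} → MovesIn F 0 xs xs
  _∷_ : ∀ {t xs ys zs} → MoveIn F xs ys → MovesIn F t ys zs → MovesIn F (suc t) xs zs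

infixr 5 _++ᴹ_

_++ᴹ_ : ∀ {F t t′ xs ys zs} → MovesIn F t xs ys → MovesIn F t′ ys zs → MovesIn F (t + t′) xs zs
[]         ++ᴹ ms′ = ms′
(mv ∷ ms)  ++ᴹ ms′ = mv ∷ (ms ++ᴹ ms′)

cast : ∀ {F t t′ xs xs′ ys ys′} → t ≡ t′ → xs ≡ xs′ → ys ≡ ys′ → MovesIn F t xs ys → MovesIn F t′ xs′ ys′
cast refl refl refl ms = ms

bring-to-front : ∀ (X b Y : List ℕ) → X ++ b ++ Y ↭ b ++ X ++ Y
bring-to-front X b Y = ↭-trans (↭P.++⁺ˡ X (↭P.++-comm b Y))
  (↭-trans (↭-reflexive (sym (ListP.++-assoc X Y b))) (↭P.++-comm (X ++ Y) b))

MoveIn⇒↭ : ∀ {F xs ys} → MoveIn F xs ys → xs ↭ ys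
MoveIn⇒↭ mv = ↭-trans (↭-reflexive source)
  (↭-trans (bring-to-front left block right)
  (↭-trans (↭-reflexive (cong (block ++_) remainder))
  (↭-trans (↭-sym (bring-to-front before block after)) (↭-reflexive (sym target)))))
  where open MoveIn mv

MovesIn⇒↭ : ∀ {F t xs ys} → MovesIn F t xs ys → xs ↭ ys
MovesIn⇒↭ []        = ↭-refl
MovesIn⇒↭ (mv ∷ ms) = ↭-trans (MoveIn⇒↭ mv) (MovesIn⇒↭ ms)

sorted-unique : ∀ {xs F} → Ascending F → xs ↭ F → sorted xs ≡ F
sorted-unique {xs} F↑ xs↭F = Pointwise.Pointwise-≡⇒≡ (SortedP.↗↭↗⇒≋ ℕP.≤-totalOrder
  (InsertionSortP.sort-↗ xs) (SortedP.AllPairs⇒Sorted ℕP.≤-totalOrder F↑)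
  (↭⇒↭ₛ′ isEquivalence (↭-trans (InsertionSortP.sort-↭ xs) xs↭F)))

take-length-++ : ∀ (A B : List ℕ) → take (length A) (A ++ B) ≡ A
take-length-++ []      B = refl
take-length-++ (x ∷ A) B = cong (x ∷_) (take-length-++ A B)

drop-length-++ : ∀ (A B : List ℕ) → drop (length A) (A ++ B) ≡ B
drop-length-++ []      B = refl
drop-length-++ (_ ∷ A) B = drop-length-++ A B

MoveIn⇒BlockMove : ∀ {F xs ys} → sorted xs ≡ F → MoveIn F xs ys → BlockMove xs ys
MoveIn⇒BlockMove refl mv = left , block , right , length before ,
  (source , isBlock) ,
  subst (λ t → length before ≤ length t) (sym remainder) (ListP.length-++-≤ˡ before) ,
  displaced ,
  (begin
    _                                                    ≡⟨ target ⟩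
    before ++ block ++ after                             ≡⟨ cong₂ (λ X Y → X ++ block ++ Y)
                                                              (take-length-++ before after)
                                                              (drop-length-++ before after) ⟨
    take k (before ++ after) ++ block ++ drop k (before ++ after)
                                                         ≡⟨ cong (λ t → take k t ++ block ++ drop k t) remainder ⟨
    take k (left ++ right) ++ block ++ drop k (left ++ right) ∎)
  where
  open MoveIn mv
  k = length before

-- Every intermediate list is a permutation of F, so F is its sorted sequence throughout.
schedule : ∀ {F t xs} → Ascending F → MovesIn F t xs F → BlockSortingSchedule xs t
schedule {F} {t} {xs} F↑ ms = subst (Moves t xs) (sym (sorted-unique F↑ (MovesIn⇒↭ ms))) (blockMoves ms)
  where
  blockMoves : ∀ {t ys} → MovesIn F t ys F → Moves t ys F
  blockMoves []        = done
  blockMoves (mv ∷ ms) =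
    step (MoveIn⇒BlockMove (sorted-unique F↑ (↭-trans (MoveIn⇒↭ mv) (MovesIn⇒↭ ms))) mv) (blockMoves ms)

concat-tabulate-split : ∀ {k} (f g : Fin k → List ℕ) i → (∀ j → j ≢ i → f j ≡ g j) →
  ∃[ P ] ∃[ Q ] concat (tabulate f) ≡ P ++ f i ++ Q × concat (tabulate g) ≡ P ++ g i ++ Q
concat-tabulate-split {suc k} f g Fin.zero f≗g =
  [] , concat (tabulate (f ∘ Fin.suc)) , refl ,
  cong (g Fin.zero ++_) (cong concat (sym (ListP.tabulate-cong (λ j → f≗g (Fin.suc j) (λ ())))))
concat-tabulate-split {suc k} f g (Fin.suc i) f≗g =
  let P , Q , f≡ , g≡ = concat-tabulate-split (f ∘ Fin.suc) (g ∘ Fin.suc) i (λ j j≢i → f≗g (Fin.suc j) (j≢i ∘ FinP.suc-injective))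
  in f Fin.zero ++ P , Q ,
     trans (cong (f Fin.zero ++_) f≡) (sym (ListP.++-assoc (f Fin.zero) P _)) ,
     trans (cong₂ _++_ (sym (f≗g Fin.zero (λ ()))) g≡) (sym (ListP.++-assoc (f Fin.zero) P _))

ʳ++-linked : ∀ {R : ℕ → ℕ → Set} {x} xs acc → Linked R (x ∷ xs) → Linked (flip R) (x ∷ acc) →
             Linked (flip R) (xs ʳ++ x ∷ acc)
ʳ++-linked []       acc _          lk′ = lk′
ʳ++-linked (y ∷ xs) acc (xRy ∷ lk) lk′ = ʳ++-linked xs _ lk (xRy ∷ lk′)

reverse-linked : ∀ {R : ℕ → ℕ → Set} {xs} → Linked R xs → Linked (flip R) (reverse xs)
reverse-linked {xs = []}     []  = []
reverse-linked {xs = x ∷ xs} lk  = ʳ++-linked xs [] lk [-]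

applyUpTo-linked : ∀ {R : ℕ → ℕ → Set} f k → (∀ t → suc t < k → R (f t) (f (suc t))) → Linked R (applyUpTo f k)
applyUpTo-linked f zero          _    = []
applyUpTo-linked f (suc zero)    _    = [-]
applyUpTo-linked f (suc (suc k)) link =
  link 0 (s≤s (s≤s z≤n)) ∷ applyUpTo-linked (f ∘ suc) (suc k) (λ t t< → link (suc t) (s≤s t<))

tabulate-toℕ : ∀ {k} (f : ℕ → ℕ) → tabulate {n = k} (f ∘ toℕ) ≡ applyUpTo f k
tabulate-toℕ {zero}  f = refl
tabulate-toℕ {suc k} f = cong (f 0 ∷_) (tabulate-toℕ {k} (f ∘ suc))

applyUpTo-++ : ∀ (f : ℕ → ℕ) a b → applyUpTo f a ++ applyUpTo (f ∘ (a +_)) b ≡ applyUpTo f (a + b)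
applyUpTo-++ f zero    b = refl
applyUpTo-++ f (suc a) b = cong (f 0 ∷_) (applyUpTo-++ (f ∘ suc) a b)

pairs : List ℕ → List ℕ
pairs []       = []
pairs (c ∷ cs) = c ∷ suc c ∷ pairs cs

pairs-++ : ∀ as bs → pairs (as ++ bs) ≡ pairs as ++ pairs bs
pairs-++ []       bs = refl
pairs-++ (c ∷ as) bs = cong (λ t → c ∷ suc c ∷ t) (pairs-++ as bs)

pairs-substring : ∀ {c cs} → c ∈ cs → Substring (c ∷ suc c ∷ []) (pairs cs)
pairs-substring {c} c∈cs = let a , b , cs≡ = ∈P.∈-∃++ c∈cs in
  pairs a , pairs b , trans (cong pairs cs≡) (pairs-++ a (c ∷ b))

pairs-ascending : ∀ {x ds} → Linked _<_ (x ∷ ds) → Linked _≤_ (x ∷ pairs ds)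
pairs-ascending [-]         = [-]
pairs-ascending (x<d ∷ lk)  = ℕP.<⇒≤ x<d ∷ ℕP.n≤1+n _ ∷ after lk
  where
  after : ∀ {d ds} → Linked _<_ (d ∷ ds) → Linked _≤_ (suc d ∷ pairs ds)
  after [-]          = [-]
  after (d<d′ ∷ lk′) = d<d′ ∷ ℕP.n≤1+n _ ∷ after lk′

-- Each move carries the leading pair c, c + 1 to the front of the pairs already reversed.
reverse-pairs : ∀ {F} W y cs → Ascending F → Linked (λ a b → a ≡ 2 + b) cs →
                (∀ {c} → c ∈ cs → y < c × Substring (c ∷ suc c ∷ []) F) →
                MovesIn F (length cs ∸ 1) (W ++ y ∷ pairs cs) (W ++ y ∷ pairs (reverse cs))
reverse-pairs W y []       F↑ _  _    = []
reverse-pairs {F} W y (c ∷ cs) F↑ lk info =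
  cast refl (cong (λ t → W ++ y ∷ c ∷ suc c ∷ t) (ListP.++-identityʳ (pairs cs))) refl
       (go c cs [] lk info)
  where
  go : ∀ c cs d → Linked (λ a b → a ≡ 2 + b) (c ∷ cs) →
       (∀ {c′} → c′ ∈ c ∷ cs → y < c′ × Substring (c′ ∷ suc c′ ∷ []) F) →
       MovesIn F (length cs) (W ++ y ∷ pairs (c ∷ cs) ++ pairs d) (W ++ y ∷ pairs ((c ∷ cs) ʳ++ d))
  go c []        d _            _    = []
  go c (c′ ∷ cs) d (c≡ ∷ lk) info′ =
    forward-move W (suc c′ ∷ pairs cs) (pairs d) detachable ∷ go c′ cs (c ∷ d) lk (info′ ∘ there)
    where
    c′<c : c′ < c
    c′<c = subst (c′ <_) (sym c≡) (ℕP.n≤1+n (suc c′))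
    detachable : Detachable F y (c ∷ suc c ∷ []) c′
    detachable = record
      { first = c ; last = suc c ; rest = suc c ∷ [] ; init = c ∷ []
      ; starts = refl ; ends = refl
      ; substring   = proj₂ (info′ (here refl))
      ; apart-left  = ¬adjacent-gap F↑ (substring⇒∈ (proj₂ (info′ (there (here refl)))))
                        (proj₁ (info′ (there (here refl)))) c′<c
      ; apart-right = ¬adjacent-descending F↑ (ℕP.<-trans c′<c (ℕP.n<1+n c))
      }

insert-split : ∀ x zs → ∃[ A ] ∃[ B ] zs ≡ A ++ B × insert x zs ≡ A ++ x ∷ B
insert-split x []       = [] , [] , refl , refl
insert-split x (z ∷ zs) with does (x ℕP.≤? z)
... | true  = [] , z ∷ zs , refl , refl
... | false = let A , B , zs≡ , ins≡ = insert-split x zs in z ∷ A , B , cong (z ∷_) zs≡ , cong (z ∷_) ins≡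

∈-insert⁺ : ∀ {y} x zs → y ∈ zs → y ∈ insert x zs
∈-insert⁺ x zs y∈zs = ↭P.∈-resp-↭ (↭-sym (InsertionSortP.insert-↭ x zs)) (there y∈zs)

∈-insert : ∀ x zs → x ∈ insert x zs
∈-insert x zs = ↭P.∈-resp-↭ (↭-sym (InsertionSortP.insert-↭ x zs)) (here refl)

-- Zone i holds the literal symbols already moved between u_i and υ_i, kept sorted.
Zones : ℕ → Set
Zones n = Vector (List ℕ) n

place : ∀ {n} → Fin n × ℕ → Zones n → Zones n
place (i , x) Z = updateAt Z i (insert x)

placeAll : ∀ {n} → List (Fin n × ℕ) → Zones n → Zones n
placeAll []       Z = Z
placeAll (o ∷ os) Z = placeAll os (place o Z)

placeAll-++ : ∀ {n} (os os′ : List (Fin n × ℕ)) Z → placeAll (os ++ os′) Z ≡ placeAll os′ (placeAll os Z)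
placeAll-++ []       os′ Z = refl
placeAll-++ (o ∷ os) os′ Z = placeAll-++ os os′ (place o Z)

place-preserves : ∀ {n} (P : Fin n → List ℕ → Set) {i x} Z → (∀ {zs} → P i zs → P i (insert x zs)) →
                  (∀ j → P j (Z j)) → ∀ j → P j (place (i , x) Z j)
place-preserves P {i} {x} Z ins Z-ok j with j FinP.≟ i
... | yes refl = subst (P j) (sym (VecFP.updateAt-updates j Z)) (ins (Z-ok j))
... | no j≢i   = subst (P j) (sym (VecFP.updateAt-minimal j i Z j≢i)) (Z-ok j)

placeAll-preserves : ∀ {n} (P : Fin n → List ℕ → Set) os Z →
                     All (λ o → ∀ {zs} → P (proj₁ o) zs → P (proj₁ o) (insert (proj₂ o) zs)) os →
                     (∀ j → P j (Z j)) → ∀ j → P j (placeAll os Z j)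
placeAll-preserves P []       Z []           Z-ok = Z-ok
placeAll-preserves P (o ∷ os) Z (ins ∷ inss) Z-ok =
  placeAll-preserves P os (place o Z) inss (place-preserves P Z ins Z-ok)

placeAll-⊇ : ∀ {n y} os (Z : Zones n) j → y ∈ Z j → y ∈ placeAll os Z j
placeAll-⊇ {y = y} os Z j y∈ = placeAll-preserves (λ j′ zs → j′ ≡ j → y ∈ zs) os Z
  (All.universal (λ o {zs} h e → ∈-insert⁺ (proj₂ o) zs (h e)) os) (λ { _ refl → y∈ }) j refl

∈-placeAll : ∀ {n o} os (Z : Zones n) → o ∈ os → proj₂ o ∈ placeAll os Z (proj₁ o)
∈-placeAll ((i , x) ∷ os) Z (here refl) = placeAll-⊇ os (place (i , x) Z) i
  (subst (x ∈_) (sym (VecFP.updateAt-updates i Z)) (∈-insert x (Z i)))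
∈-placeAll (o′ ∷ os) Z (there o∈os) = ∈-placeAll os (place o′ Z) o∈os

module Ranks (n m : ℕ) where

  ρ : Sym n m → ℕ
  ρ = rank

  -- ρℓ t is the rank of ℓ^(t+1); r^(t+1) has the next rank.
  ρℓ : ℕ → ℕ
  ρℓ t = ρ s + 1 + 2 * (m + n ∸ suc t)

  ρ-r : ∀ k → ρ (r k) ≡ suc (ρℓ (toℕ k))
  ρ-r k = cong (_+ 2 * (m + n ∸ suc (toℕ k))) (ℕP.+-suc (ρ s) 1)

  ℓ-step : ∀ t → suc t < m + n → ρℓ t ≡ 2 + ρℓ (suc t)
  ℓ-step t t<m+n = begin
    ρ s + 1 + 2 * (m + n ∸ suc t)              ≡⟨ cong (λ d → ρ s + 1 + 2 * d) (ℕP.+-∸-assoc 1 t<m+n) ⟩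
    ρ s + 1 + 2 * suc (m + n ∸ suc (suc t))    ≡⟨ double-suc (ρ s) _ ⟩
    2 + ρℓ (suc t)                             ∎
    where
    double-suc : ∀ a d → a + 1 + 2 * suc d ≡ 2 + (a + 1 + 2 * d)
    double-suc = solve-∀

  reversed-index<m : ∀ (j : Fin m) → m ∸ suc (toℕ j) < m
  reversed-index<m j = ℕP.∸-monoʳ-< (s≤s z≤n) (FinP.toℕ<n j)

  InZone : Fin n → ℕ → Set
  InZone i x = ρ (u i) < x × x < ρ (υ i)

  zone-offset : ∀ a d → d < 4 * m → a < a + 1 + d × a + 1 + d < a + 4 * m + 1
  zone-offset a d d<4m =
    ℕP.≤-trans (ℕP.≤-reflexive (ℕP.+-comm 1 a)) (ℕP.m≤m+n (a + 1) d) ,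
    subst (_< a + 4 * m + 1) (swap-last a d) (ℕP.+-monoˡ-< 1 (ℕP.+-monoʳ-< a d<4m))
    where
    swap-last : ∀ a d → a + d + 1 ≡ a + 1 + d
    swap-last = solve-∀

  in-zone : ∀ i k d → k ≤ 3 → d < m → InZone i (ρ (u i) + 1 + (k * m + d))
  in-zone i k d k≤3 d<m = zone-offset (ρ (u i)) (k * m + d) (ℕP.<-≤-trans (ℕP.+-monoʳ-< (k * m) d<m)
    (subst (_≤ 4 * m) (ℕP.+-comm m (k * m)) (ℕP.*-monoˡ-≤ m (s≤s k≤3))))

  left-in-zone : ∀ j z → InZone (Literal.var z) (ρ (leftSym j z))
  left-in-zone j (lit i true)  = in-zone i 0 _ z≤n (reversed-index<m j)
  left-in-zone j (lit i false) = subst (InZone i) (regroup (ρ (u i)) m _) (in-zone i 1 _ (s≤s z≤n) (reversed-index<m j))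
    where
    regroup : ∀ a m′ d → a + 1 + (1 * m′ + d) ≡ a + 1 + m′ + d
    regroup = solve-∀

  right-in-zone : ∀ j z → InZone (Literal.var z) (ρ (rightSym j z))
  right-in-zone j (lit i true)  =
    subst (InZone i) (sym (ℕP.+-assoc (ρ (u i) + 1) (2 * m) (toℕ j))) (in-zone i 2 _ (s≤s (s≤s z≤n)) (FinP.toℕ<n j))
  right-in-zone j (lit i false) =
    subst (InZone i) (sym (ℕP.+-assoc (ρ (u i) + 1) (3 * m) (toℕ j))) (in-zone i 3 _ (s≤s (s≤s (s≤s z≤n))) (FinP.toℕ<n j))

  zone-end< : ∀ b a → b < a → b * (4 * m + 2) + 4 * m + 1 < a * (4 * m + 2)
  zone-end< b a b<a = subst (_≤ a * (4 * m + 2)) (sym (next-zone b m)) (ℕP.*-monoˡ-≤ (4 * m + 2) b<a)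
    where
    next-zone : ∀ b m → suc (b * (4 * m + 2) + 4 * m + 1) ≡ suc b * (4 * m + 2)
    next-zone = solve-∀

  υ<u : ∀ {i i′} → toℕ i < toℕ i′ → ρ (υ i) < ρ (u i′)
  υ<u {i} {i′} = zone-end< (toℕ i) (toℕ i′)

  zone-below : ∀ {i i′ x y} → toℕ i < toℕ i′ → InZone i x → InZone i′ y → x < y
  zone-below i<i′ (_ , x<υ) (u<y , _) = ℕP.<-trans x<υ (ℕP.<-trans (υ<u i<i′) u<y)

  υ<s : ∀ i → ρ (υ i) < ρ s
  υ<s i = zone-end< (toℕ i) n (FinP.toℕ<n i)

  u<υ : ∀ i → ρ (u i) < ρ (υ i)
  u<υ i = ℕP.≤-<-trans (ℕP.m≤m+n (ρ (u i)) (4 * m)) (ℕP.m<m+n _ (s≤s z≤n))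

  s<ℓ : ∀ t → ρ s < ρℓ t
  s<ℓ t = ℕP.≤-trans (ℕP.≤-reflexive (ℕP.+-comm 1 (ρ s))) (ℕP.m≤m+n (ρ s + 1) _)

schedule-length-pos : ∀ a b → 1 ≤ a + b → 6 * a + (b + (a + b ∸ 1)) ≡ 7 * a + 2 * b ∸ 1
schedule-length-pos a b 1≤a+b = begin
  6 * a + (b + (a + b ∸ 1))    ≡⟨ ℕP.+-assoc (6 * a) b _ ⟨
  6 * a + b + (a + b ∸ 1)      ≡⟨ ℕP.+-∸-assoc (6 * a + b) 1≤a+b ⟨
  6 * a + b + (a + b) ∸ 1      ≡⟨ cong (_∸ 1) (collect a b) ⟩
  7 * a + 2 * b ∸ 1            ∎
  where
  collect : ∀ a b → 6 * a + b + (a + b) ≡ 7 * a + 2 * b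
  collect = solve-∀

schedule-length : ∀ a b → 6 * a + (b + (a + b ∸ 1)) ≡ 7 * a + 2 * b ∸ 1
schedule-length zero    zero    = refl
schedule-length zero    (suc b) = schedule-length-pos zero (suc b) (s≤s z≤n)
schedule-length (suc a) b       = schedule-length-pos (suc a) b (s≤s z≤n)

module Construction (n m : ℕ) (Φ : CNF3 n m) where
  open Ranks n m

  leftOp rightOp : Fin m → Literal n → Fin n × ℕ
  leftOp  j z = Literal.var z , ρ (leftSym j z)
  rightOp j z = Literal.var z , ρ (rightSym j z)

  -- The literal symbols of clause j in encoding order, each tagged with the zone it moves to.
  literalOps : Fin m → Clause n → List (Fin n × ℕ)
  literalOps j (clause za zb zc _ _) =
    leftOp j za ∷ leftOp j zb ∷ leftOp j zc ∷ rightOp j za ∷ rightOp j zb ∷ rightOp j zc ∷ []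

  clauseOps : ∀ {k} → (Fin k → Fin m) → Vec (Clause n) k → List (Fin n × ℕ)
  clauseOps g cs = concat (toList (V.zipWith literalOps (V.tabulate g) cs))

  encoded : ∀ {k} → (Fin k → Fin m) → Vec (Clause n) k → List ℕ
  encoded g cs = map ρ (concat (toList (V.zipWith encodeClause (V.tabulate g) cs)))

  empty : Zones n
  empty _ = []

  final : Zones n
  final = placeAll (clauseOps id Φ) empty

  bracket : Fin n → List ℕ → List ℕ
  bracket i zs = ρ (u i) ∷ zs ++ ρ (υ i) ∷ []

  varBlock : Zones n → Fin n → List ℕ
  varBlock Z i = ρℓ (m + toℕ i) ∷ bracket i (Z i) ++ suc (ρℓ (m + toℕ i)) ∷ []

  vars : Zones n → List ℕ
  vars Z = concat (tabulate (varBlock Z))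

  zoneBlock : Fin n → List ℕ
  zoneBlock i = bracket i (final i)

  ℓs : List ℕ
  ℓs = applyUpTo ρℓ (m + n)

  -- The sorted sequence of π, written out.
  F : List ℕ
  F = concat (tabulate zoneBlock) ++ ρ s ∷ pairs (reverse ℓs)

  encodeClause-ranks : ∀ j c → map ρ (encodeClause j c) ≡
    ρℓ (toℕ j) ∷ map proj₂ (literalOps j c) ++ suc (ρℓ (toℕ j)) ∷ []
  encodeClause-ranks j (clause _ _ _ _ _) rewrite ρ-r (j ↑ˡ n) | FinP.toℕ-↑ˡ j n = refl

  encodeVars-ranks : ∀ {k} (h : Fin k → Fin n) →
    map ρ (concat (map (λ i → ℓ (m ↑ʳ i) ∷ u i ∷ υ i ∷ r (m ↑ʳ i) ∷ []) (tabulate h)))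
      ≡ concat (tabulate (varBlock empty ∘ h))
  encodeVars-ranks {zero}  h = refl
  encodeVars-ranks {suc k} h = trans (ListP.map-++ ρ (ℓ (m ↑ʳ i) ∷ u i ∷ υ i ∷ r (m ↑ʳ i) ∷ []) _)
    (cong₂ _++_ var-ranks (encodeVars-ranks (h ∘ Fin.suc)))
    where
    i = h Fin.zero
    var-ranks : ρ (ℓ (m ↑ʳ i)) ∷ ρ (u i) ∷ ρ (υ i) ∷ ρ (r (m ↑ʳ i)) ∷ [] ≡ varBlock empty i
    var-ranks rewrite ρ-r (m ↑ʳ i) | FinP.toℕ-↑ʳ m i = refl

  π-ranks : π Φ ≡ ρ s ∷ encoded id Φ ++ vars empty
  π-ranks = cong (ρ s ∷_) (trans (ListP.map-++ ρ (encodeClauses Φ) encodeVars)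
                                  (cong (encoded id Φ ++_) (encodeVars-ranks id)))

  OpInZone : Fin n × ℕ → Set
  OpInZone (i , x) = InZone i x

  literalOps-in-zone : ∀ j c → All OpInZone (literalOps j c)
  literalOps-in-zone j (clause za zb zc _ _) =
    left-in-zone j za ∷ left-in-zone j zb ∷ left-in-zone j zc ∷
    right-in-zone j za ∷ right-in-zone j zb ∷ right-in-zone j zc ∷ []

  ops-in-zone : ∀ {k} (g : Fin k → Fin m) cs → All OpInZone (clauseOps g cs)
  ops-in-zone g V.[]        = []
  ops-in-zone g (c V.∷ cs) = AllP.++⁺ (literalOps-in-zone (g Fin.zero) c) (ops-in-zone (g ∘ Fin.suc) cs)

  final-sorted : ∀ i → Linked _≤_ (final i) × All (InZone i) (final i)
  final-sorted = placeAll-preserves (λ i zs → Linked _≤_ zs × All (InZone i) zs) (clauseOps id Φ) empty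
    (All.map (λ {o} o∈zone {zs} (sorted , inZone) →
               InsertionSortP.insert-↗ (proj₂ o) sorted ,
               ↭P.All-resp-↭ (↭-sym (InsertionSortP.insert-↭ (proj₂ o) zs)) (o∈zone ∷ inZone))
             (ops-in-zone id Φ))
    (λ _ → [] , [])

  zoneBlock-bounds : ∀ i → All (λ x → ρ (u i) ≤ x × x ≤ ρ (υ i)) (zoneBlock i)
  zoneBlock-bounds i = (ℕP.≤-refl , ℕP.<⇒≤ (u<υ i)) ∷
    AllP.++⁺ (All.map (λ (u<x , x<υ) → ℕP.<⇒≤ u<x , ℕP.<⇒≤ x<υ) (proj₂ (final-sorted i)))
             ((ℕP.<⇒≤ (u<υ i) , ℕP.≤-refl) ∷ [])

  zoneBlock-ascending : ∀ i → Ascending (zoneBlock i)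
  zoneBlock-ascending i = All.map proj₁ (All.tail (zoneBlock-bounds i)) ∷
    AllPairsP.++⁺ (LinkedP.Linked⇒AllPairs ℕP.≤-trans (proj₁ (final-sorted i))) ([] ∷ [])
                  (All.map (λ (_ , x<υ) → ℕP.<⇒≤ x<υ ∷ []) (proj₂ (final-sorted i)))

  zones-ascending : Ascending (concat (tabulate zoneBlock))
  zones-ascending = AllPairsP.concat⁺ (AllP.tabulate⁺ zoneBlock-ascending)
    (AllPairsP.tabulate⁺-< λ {i} {j} i<j → All.map (λ (_ , x≤υ) → All.map (λ (u≤y , _) →
      ℕP.≤-trans x≤υ (ℕP.≤-trans (ℕP.<⇒≤ (υ<u i<j)) u≤y)) (zoneBlock-bounds j)) (zoneBlock-bounds i))

  zones<s : All (_< ρ s) (concat (tabulate zoneBlock))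
  zones<s = AllP.concat⁺ (AllP.tabulate⁺ λ i →
    All.map (λ (_ , x≤υ) → ℕP.≤-<-trans x≤υ (υ<s i)) (zoneBlock-bounds i))

  s<ℓs : ∀ {c} → c ∈ ℓs → ρ s < c
  s<ℓs c∈ℓs with ∈P.∈-applyUpTo⁻ ρℓ c∈ℓs
  ... | t , _ , refl = s<ℓ t

  ℓs-linked : Linked (λ a b → a ≡ 2 + b) ℓs
  ℓs-linked = applyUpTo-linked ρℓ (m + n) ℓ-step

  pairs-tail-ascending : Ascending (ρ s ∷ pairs (reverse ℓs))
  pairs-tail-ascending = LinkedP.Linked⇒AllPairs ℕP.≤-trans (pairs-ascending
    (s-first (reverse ℓs) ascending (λ c∈ → s<ℓs (↭P.∈-resp-↭ (↭P.↭-reverse ℓs) c∈))))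
    where
    ascending : Linked _<_ (reverse ℓs)
    ascending = Linked.map (λ {a} b≡ → subst (a <_) (sym b≡) (ℕP.n≤1+n (suc a)))
                           (reverse-linked ℓs-linked)
    s-first : ∀ cs → Linked _<_ cs → (∀ {c} → c ∈ cs → ρ s < c) → Linked _<_ (ρ s ∷ cs)
    s-first []      _  _ = [-]
    s-first (c ∷ _) lk s< = s< (here refl) ∷ lk

  F-ascending : Ascending F
  F-ascending = AllPairsP.++⁺ zones-ascending pairs-tail-ascending
    (All.map (λ x<s → All.map (ℕP.≤-trans (ℕP.<⇒≤ x<s)) s≤tail) zones<s)
    where
    s≤tail : All (ρ s ≤_) (ρ s ∷ pairs (reverse ℓs))
    s≤tail with pairs-tail-ascending
    ... | s≤ ∷ _ = ℕP.≤-refl ∷ s≤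

  final⊆F : ∀ {i x} → x ∈ final i → x ∈ F
  final⊆F {i} x∈ = ∈P.∈-++⁺ˡ (∈P.∈-concat⁺′ (there (∈P.∈-++⁺ˡ x∈)) (∈P.∈-tabulate⁺ i))

  υ∈F : ∀ i → ρ (υ i) ∈ F
  υ∈F i = ∈P.∈-++⁺ˡ (∈P.∈-concat⁺′ (there (∈P.∈-++⁺ʳ (final i) (here refl))) (∈P.∈-tabulate⁺ i))

  s∈F : ρ s ∈ F
  s∈F = ∈P.∈-++⁺ʳ (concat (tabulate zoneBlock)) (here refl)

  zoneBlock-substring : ∀ i → Substring (zoneBlock i) F
  zoneBlock-substring i =
    let P , Q , zones≡ , _ = concat-tabulate-split zoneBlock zoneBlock i (λ _ _ → refl) in
    P , Q ++ tail , (begin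
      concat (tabulate zoneBlock) ++ tail   ≡⟨ cong (_++ tail) zones≡ ⟩
      (P ++ zoneBlock i ++ Q) ++ tail       ≡⟨ ListP.++-assoc P _ tail ⟩
      P ++ (zoneBlock i ++ Q) ++ tail       ≡⟨ cong (P ++_) (ListP.++-assoc (zoneBlock i) Q tail) ⟩
      P ++ zoneBlock i ++ Q ++ tail         ∎)
    where tail = ρ s ∷ pairs (reverse ℓs)

  ℓ-pair-substring : ∀ {c} → c ∈ ℓs → Substring (c ∷ suc c ∷ []) F
  ℓ-pair-substring c∈ℓs =
    let a , b , pairs≡ = pairs-substring (↭P.∈-resp-↭ (↭-sym (↭P.↭-reverse ℓs)) c∈ℓs) in
    zones ++ ρ s ∷ a , b ,
    trans (cong (λ t → zones ++ ρ s ∷ t) pairs≡) (sym (ListP.++-assoc zones (ρ s ∷ a) _))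
    where zones = concat (tabulate zoneBlock)

  vars-insert : ∀ Z i x → ∃[ Q ] ∃[ S ] vars Z ≡ Q ++ S × vars (place (i , x) Z) ≡ Q ++ x ∷ S
  vars-insert Z i x
    with concat-tabulate-split (varBlock Z) (varBlock (place (i , x) Z)) i
           (λ j j≢i → cong (λ t → ρℓ (m + toℕ j) ∷ bracket j t ++ suc (ρℓ (m + toℕ j)) ∷ [])
                           (sym (VecFP.updateAt-minimal j i Z j≢i)))
       | insert-split x (Z i)
  ... | P , Q , vars≡ , vars′≡ | A , B , Zᵢ≡ , ins≡ =
    P ++ ℓᵢ ∷ ρ (u i) ∷ A , B ++ ρ (υ i) ∷ suc ℓᵢ ∷ Q ,
    (begin
      vars Z                                       ≡⟨ vars≡ ⟩
      P ++ frame (Z i) ++ Q                        ≡⟨ cong (λ t → P ++ frame t ++ Q) Zᵢ≡ ⟩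
      P ++ frame (A ++ B) ++ Q                     ≡⟨ regroup B ⟩
      (P ++ ℓᵢ ∷ ρ (u i) ∷ A) ++ B ++ ρ (υ i) ∷ suc ℓᵢ ∷ Q ∎) ,
    (begin
      vars (place (i , x) Z)                       ≡⟨ vars′≡ ⟩
      P ++ frame (place (i , x) Z i) ++ Q          ≡⟨ cong (λ t → P ++ frame t ++ Q) (VecFP.updateAt-updates i Z) ⟩
      P ++ frame (insert x (Z i)) ++ Q             ≡⟨ cong (λ t → P ++ frame t ++ Q) ins≡ ⟩
      P ++ frame (A ++ x ∷ B) ++ Q                 ≡⟨ regroup (x ∷ B) ⟩
      (P ++ ℓᵢ ∷ ρ (u i) ∷ A) ++ x ∷ B ++ ρ (υ i) ∷ suc ℓᵢ ∷ Q ∎)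
    where
    ℓᵢ = ρℓ (m + toℕ i)
    frame : List ℕ → List ℕ
    frame zs = ℓᵢ ∷ bracket i zs ++ suc ℓᵢ ∷ []
    regroup′ : ∀ (P Q A B ℓ₀ u₀ υ₀ r₀ : List ℕ) →
               P ++ (ℓ₀ ++ (u₀ ++ (A ++ B) ++ υ₀) ++ r₀) ++ Q ≡ (P ++ ℓ₀ ++ u₀ ++ A) ++ B ++ υ₀ ++ r₀ ++ Q
    regroup′ _ _ _ _ _ _ _ _ = solve (ListP.++-monoid ℕ)
    regroup : ∀ B′ → P ++ frame (A ++ B′) ++ Q ≡ (P ++ ℓᵢ ∷ ρ (u i) ∷ A) ++ B′ ++ ρ (υ i) ∷ suc ℓᵢ ∷ Q
    regroup B′ = regroup′ P Q A B′ (ℓᵢ ∷ []) (ρ (u i) ∷ []) (ρ (υ i) ∷ []) (suc ℓᵢ ∷ [])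

  place-literal : ∀ P L x w Y Z i → x < L → x ∈ F → ¬ Adjacent F x w →
    MovesIn F 1 (P ++ L ∷ x ∷ w ∷ Y ++ vars Z) (P ++ L ∷ w ∷ Y ++ vars (place (i , x) Z))
  place-literal P L x w Y Z i x<L x∈F x≁w with vars-insert Z i x
  ... | Q , S , vars≡ , vars′≡ =
    cast refl (cong (λ t → P ++ L ∷ x ∷ w ∷ t) (shift vars≡)) (cong (λ t → P ++ L ∷ w ∷ t) (shift vars′≡))
      (forward-move P (Y ++ Q) S (singleton-detachable x∈F (¬adjacent-descending F-ascending x<L) x≁w) ∷ [])
    where
    shift : ∀ {V T} → V ≡ Q ++ T → (Y ++ Q) ++ T ≡ Y ++ V
    shift V≡ = trans (ListP.++-assoc Y Q _) (cong (Y ++_) (sym V≡))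

  place-literals : ∀ P L R E os Z → All (λ o → proj₂ o < L) os → All (λ o → proj₂ o ∈ F) os →
    Linked (λ x y → ¬ Adjacent F x y) (map proj₂ os ++ R ∷ []) →
    MovesIn F (length os) (P ++ L ∷ (map proj₂ os ++ R ∷ E) ++ vars Z) (P ++ L ∷ R ∷ E ++ vars (placeAll os Z))
  place-literals P L R E [] Z _ _ _ = []
  place-literals P L R E ((i , x) ∷ []) Z (x<L ∷ []) (x∈F ∷ []) (x≁R ∷ _) =
    place-literal P L x R E Z i x<L x∈F x≁R
  place-literals P L R E ((i , x) ∷ o′ ∷ os) Z (x<L ∷ <L) (x∈F ∷ ∈F) (x≁ ∷ lk) =
    place-literal P L x (proj₂ o′) (map proj₂ os ++ R ∷ E) Z i x<L x∈F x≁
    ++ᴹ place-literals P L R E (o′ ∷ os) (place (i , x) Z) <L ∈F lk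

  apart-descending : ∀ {i i′ x y} → toℕ i < toℕ i′ → InZone i x → InZone i′ y → ¬ Adjacent F y x
  apart-descending i<i′ x∈ y∈ = ¬adjacent-descending F-ascending (zone-below i<i′ x∈ y∈)

  -- The right symbol of z_c and r^j are separated by s, the left symbol of z_c and the
  -- right symbol of z_a by υ_c; all other consecutive literal symbols are in descending order.
  clause-moves : ∀ P E Z j c → All (λ o → proj₂ o ∈ F) (literalOps j c) →
    MovesIn F 6 (P ++ ρℓ (toℕ j) ∷ (map proj₂ (literalOps j c) ++ suc (ρℓ (toℕ j)) ∷ E) ++ vars Z)
                (P ++ ρℓ (toℕ j) ∷ suc (ρℓ (toℕ j)) ∷ E ++ vars (placeAll (literalOps j c) Z))
  clause-moves P E Z j c@(clause za zb zc a>b b>c) ∈F =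
    place-literals P L (suc L) E (literalOps j c) Z
      (All.map (λ {o} (_ , x<υ) → ℕP.<-trans x<υ (ℕP.<-trans (υ<s (proj₁ o)) (s<ℓ (toℕ j)))) (literalOps-in-zone j c))
      ∈F
      (apart-descending a>b (left-in-zone j zb) (left-in-zone j za) ∷
       apart-descending b>c (left-in-zone j zc) (left-in-zone j zb) ∷
       ¬adjacent-gap F-ascending (υ∈F (Literal.var zc)) (proj₂ (left-in-zone j zc))
         (ℕP.<-trans (υ<u (ℕP.<-trans b>c a>b)) (proj₁ (right-in-zone j za))) ∷
       apart-descending a>b (right-in-zone j zb) (right-in-zone j za) ∷
       apart-descending b>c (right-in-zone j zc) (right-in-zone j zb) ∷
       ¬adjacent-gap F-ascending s∈F (ℕP.<-trans (proj₂ (right-in-zone j zc)) (υ<s (Literal.var zc)))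
         (ℕP.<-trans (s<ℓ (toℕ j)) (ℕP.n<1+n L)) ∷
       [-])
    where L = ρℓ (toℕ j)

  phase₁ : ∀ {k} (g : Fin k → Fin m) cs D Z → placeAll (clauseOps g cs) Z ≡ final →
    MovesIn F (6 * k) (ρ s ∷ D ++ encoded g cs ++ vars Z)
                      (ρ s ∷ (D ++ pairs (tabulate (ρℓ ∘ toℕ ∘ g))) ++ vars final)
  phase₁ g V.[] D Z Z≡final =
    cast refl refl (cong₂ (λ t Z′ → ρ s ∷ t ++ vars Z′) (sym (ListP.++-identityʳ D)) Z≡final) []
  phase₁ {suc k} g (c V.∷ cs) D Z ops≡final =
    cast (sym (ℕP.*-suc 6 k)) (cong (λ t → ρ s ∷ D ++ t ++ vars Z) (sym clause≡))
         (cong (λ t → ρ s ∷ t ++ vars final) (ListP.++-assoc D (L ∷ suc L ∷ []) _))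
      (clause-moves (ρ s ∷ D) E Z j c (All.tabulate λ o∈ → final⊆F (subst (λ Z′ → _ ∈ Z′ _) ops≡final
         (∈-placeAll (literalOps j c ++ clauseOps (g ∘ Fin.suc) cs) Z (∈P.∈-++⁺ˡ o∈))))
       ++ᴹ cast refl (cong (λ t → ρ s ∷ t) (ListP.++-assoc D (L ∷ suc L ∷ []) _)) refl
             (phase₁ (g ∘ Fin.suc) cs (D ++ L ∷ suc L ∷ []) (placeAll (literalOps j c) Z)
               (trans (sym (placeAll-++ (literalOps j c) (clauseOps (g ∘ Fin.suc) cs) Z)) ops≡final)))
    where
    j = g Fin.zero
    L = ρℓ (toℕ j)
    E = encoded (g ∘ Fin.suc) cs
    clause≡ : encoded g (c V.∷ cs) ≡ L ∷ (map proj₂ (literalOps j c) ++ suc L ∷ E)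
    clause≡ = begin
      encoded g (c V.∷ cs)                                  ≡⟨ ListP.map-++ ρ (encodeClause j c) _ ⟩
      map ρ (encodeClause j c) ++ E                         ≡⟨ cong (_++ E) (encodeClause-ranks j c) ⟩
      (L ∷ map proj₂ (literalOps j c) ++ suc L ∷ []) ++ E   ≡⟨ cong (L ∷_) (ListP.++-assoc (map proj₂ (literalOps j c)) (suc L ∷ []) E) ⟩
      L ∷ (map proj₂ (literalOps j c) ++ suc L ∷ E)         ∎

  phase₂ : ∀ {k} (h : Fin k → Fin n) Vd P →
    MovesIn F k (Vd ++ ρ s ∷ P ++ concat (tabulate (varBlock final ∘ h)))
                (Vd ++ concat (tabulate (zoneBlock ∘ h)) ++ ρ s ∷ P ++ pairs (tabulate (λ i → ρℓ (m + toℕ (h i)))))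
  phase₂ {zero}  h Vd P = []
  phase₂ {suc k} h Vd P =
    cast refl (cong (λ t → Vd ++ ρ s ∷ P ++ ℓᵢ ∷ t) (sym (ListP.++-assoc (zoneBlock i) (suc ℓᵢ ∷ []) S)))
              (regroup-middle Vd (zoneBlock i) P (ℓᵢ ∷ []) (suc ℓᵢ ∷ []) S)
      (backward-move Vd (ρ s ∷ P) S detachable ∷ [])
    ++ᴹ cast refl refl (regroup-end Vd (zoneBlock i) _ P (ℓᵢ ∷ []) (suc ℓᵢ ∷ []) _)
          (phase₂ (h ∘ Fin.suc) (Vd ++ zoneBlock i) (P ++ ℓᵢ ∷ suc ℓᵢ ∷ []))
    where
    i = h Fin.zero
    ℓᵢ = ρℓ (m + toℕ i)
    S = concat (tabulate (varBlock final ∘ h ∘ Fin.suc))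
    detachable : Detachable F ℓᵢ (zoneBlock i) (suc ℓᵢ)
    detachable = record
      { first = ρ (u i) ; last = ρ (υ i) ; rest = final i ++ ρ (υ i) ∷ [] ; init = ρ (u i) ∷ final i
      ; starts = refl ; ends = refl
      ; substring   = zoneBlock-substring i
      ; apart-left  = ¬adjacent-descending F-ascending
                        (ℕP.<-trans (u<υ i) (ℕP.<-trans (υ<s i) (s<ℓ (m + toℕ i))))
      ; apart-right = ¬adjacent-gap F-ascending s∈F (υ<s i) (ℕP.<-trans (s<ℓ (m + toℕ i)) (ℕP.n<1+n ℓᵢ))
      }
    regroup-middle : ∀ (Vd b P ℓ₀ r₀ S : List ℕ) →
      Vd ++ b ++ (ρ s ∷ P) ++ ℓ₀ ++ r₀ ++ S ≡ (Vd ++ b) ++ ρ s ∷ (P ++ ℓ₀ ++ r₀) ++ S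
    regroup-middle Vd b P ℓ₀ r₀ S = monoid Vd b (ρ s ∷ []) P ℓ₀ r₀ S
      where
      monoid : ∀ (Vd b σ P ℓ₀ r₀ S : List ℕ) →
        Vd ++ b ++ (σ ++ P) ++ ℓ₀ ++ r₀ ++ S ≡ (Vd ++ b) ++ σ ++ (P ++ ℓ₀ ++ r₀) ++ S
      monoid _ _ _ _ _ _ _ = solve (ListP.++-monoid ℕ)
    regroup-end : ∀ (Vd b C P ℓ₀ r₀ T : List ℕ) →
      (Vd ++ b) ++ C ++ ρ s ∷ (P ++ ℓ₀ ++ r₀) ++ T ≡ Vd ++ (b ++ C) ++ ρ s ∷ P ++ ℓ₀ ++ r₀ ++ T
    regroup-end Vd b C P ℓ₀ r₀ T = monoid Vd b C (ρ s ∷ []) P ℓ₀ r₀ T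
      where
      monoid : ∀ (Vd b C σ P ℓ₀ r₀ T : List ℕ) →
        (Vd ++ b) ++ C ++ σ ++ (P ++ ℓ₀ ++ r₀) ++ T ≡ Vd ++ (b ++ C) ++ σ ++ P ++ ℓ₀ ++ r₀ ++ T
      monoid _ _ _ _ _ _ _ _ = solve (ListP.++-monoid ℕ)

  moves : MovesIn F (7 * m + 2 * n ∸ 1) (π Φ) F
  moves = cast length≡ (sym π-ranks) refl
    (phase₁ id Φ [] empty refl
     ++ᴹ cast refl refl (cong (λ t → zones ++ ρ s ∷ t) ℓ-pairs) (phase₂ id [] (pairs (tabulate {n = m} (ρℓ ∘ toℕ))))
     ++ᴹ reverse-pairs zones (ρ s) ℓs F-ascending ℓs-linked (λ c∈ → s<ℓs c∈ , ℓ-pair-substring c∈))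
    where
    zones = concat (tabulate zoneBlock)
    ℓ-pairs : pairs (tabulate {n = m} (ρℓ ∘ toℕ)) ++ pairs (tabulate {n = n} (λ i → ρℓ (m + toℕ i))) ≡ pairs ℓs
    ℓ-pairs = begin
      pairs (tabulate {n = m} (ρℓ ∘ toℕ)) ++ pairs (tabulate {n = n} (λ i → ρℓ (m + toℕ i)))
        ≡⟨ pairs-++ (tabulate {n = m} (ρℓ ∘ toℕ)) _ ⟨
      pairs (tabulate {n = m} (ρℓ ∘ toℕ) ++ tabulate {n = n} (λ i → ρℓ (m + toℕ i)))
        ≡⟨ cong pairs (cong₂ _++_ (tabulate-toℕ {m} ρℓ) (tabulate-toℕ {n} (ρℓ ∘ (m +_)))) ⟩
      pairs (applyUpTo ρℓ m ++ applyUpTo (ρℓ ∘ (m +_)) n)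
        ≡⟨ cong pairs (applyUpTo-++ ρℓ m n) ⟩
      pairs ℓs ∎
    length≡ : 6 * m + (n + (length ℓs ∸ 1)) ≡ 7 * m + 2 * n ∸ 1
    length≡ = trans (cong (λ t → 6 * m + (n + (t ∸ 1))) (ListP.length-applyUpTo ρℓ (m + n))) (schedule-length m n)

corollary1 : (n m : ℕ) (Φ : CNF3 n m) →
    BlockSortingSchedule (π Φ) (7 * m + 2 * n ∸ 1)
corollary1 n m Φ = schedule F-ascending moves
  where open Construction n m Φ
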